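{- Let $G$ be a finitely generated Abelian group, $L\ge1$, and $c_1,\dots,c_U\in\mathbb{Z}/L\mathbb{Z}$. Then the property of a tuple of functions $\alpha_1,\dots,\alpha_U:G\to\mathbb{Z}/L\mathbb{Z}$ that $c_1\alpha_1(x)+\dots+c_U\alpha_U(x)=0$ for all $x\in G$ is expressible, and a witnessing system of functional equations can be constructed explicitly from $G$, $L$ and $c_1,\dots,c_U$.
   Context: For $G$ finitely generated Abelian and $H$ finite Abelian, a $(G,H)$-property is a set $P$ of functions $\alpha:G\to H$. It is expressible if there exist $M\in\mathbb{N}$, and for $i=1,\dots,M$ numbers $J_i$, sets $E'_i\subset H$, shifts $h_{i,j}\in G$ and sets $E_{i,j}\subset H$ ($j\le J_i$), such that $\alpha\in P$ iff for all $i$ and $x\in G$ the sets $\alpha(x+h_{i,j})+E_{i,j}$ ($j=1,\dots,J_i$) are pairwise disjoint with union $E'_i$ (the witnessing system). A property of a tuple $(\alpha_u:G\to H_u)_{u}$ is identified with a $(G,\prod_uH_u)$-property, and is expressible if that one is. -}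

module Defs where

open import Level using (Level; _⊔_; suc)
open import Algebra.Bundles using (AbelianGroup)
open import Data.Nat using (ℕ; zero; NonZero) renaming (suc to sucℕ; _+_ to _+ℕ_; _*_ to _*ℕ_)
open import Data.Nat.DivMod using (_mod_)
open import Data.Fin using (Fin; toℕ) renaming (zero to fzero; suc to fsuc)
open import Data.Integer using (ℤ; +_; -[1+_])
open import Data.Vec using (Vec; zipWith; foldr′)
open import Data.Bool using (Bool; true)
open import Data.Product using (Σ; ∃; _×_; _,_; proj₁)
open import Relation.Binary.PropositionalEquality using (_≡_; _≢_)
open import Relation.Nullary using (¬_)

-- Z/LZ, represented as Fin L with arithmetic mod L

module _ (L : ℕ) .{{_ : NonZero L}} where

  _+L_ : Fin L → Fin L → Fin L
  a +L b = (toℕ a +ℕ toℕ b) mod L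

  _*L_ : Fin L → Fin L → Fin L
  a *L b = (toℕ a *ℕ toℕ b) mod L

  0L : Fin L
  0L = 0 mod L

  _⊕_ : ∀ {U} → Vec (Fin L) U → Vec (Fin L) U → Vec (Fin L) U
  _⊕_ = zipWith _+L_

  linForm : ∀ {U} → Vec (Fin L) U → Vec (Fin L) U → Fin L
  linForm cs ys = foldr′ _+L_ 0L (zipWith _*L_ cs ys)

module _ {c ℓ} (G : AbelianGroup c ℓ) where
  open AbelianGroup G

  _·ⁿ_ : ℕ → Carrier → Carrier
  zero ·ⁿ g = ε
  sucℕ n ·ⁿ g = g ∙ (n ·ⁿ g)

  _·ᶻ_ : ℤ → Carrier → Carrier
  (+ n) ·ᶻ g = n ·ⁿ g
  -[1+ n ] ·ᶻ g = (sucℕ n ·ⁿ g) ⁻¹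

  linComb : (n : ℕ) → (Fin n → ℤ) → (Fin n → Carrier) → Carrier
  linComb zero k g = ε
  linComb (sucℕ n) k g = (k fzero ·ᶻ g fzero) ∙ linComb n (λ i → k (fsuc i)) (λ i → g (fsuc i))

  IsFinitelyGenerated : Set (c ⊔ ℓ)
  IsFinitelyGenerated =
    Σ ℕ λ n → Σ (Fin n → Carrier) λ gens →
      ∀ x → Σ (Fin n → ℤ) λ k → linComb n k gens ≈ x

  Fun : Set → Set (c ⊔ ℓ)
  Fun H = Σ (Carrier → H) λ f → ∀ {x y} → x ≈ y → f x ≡ f y

  -- subsets of H (H finite) as Boolean-valued predicates
  -- y ∈ a + E
  InTranslate : {H : Set} (_⊕H_ : H → H → H) → H → H → (H → Bool) → Set
  InTranslate {H} _⊕H_ y a E = Σ H λ e → E e ≡ true × y ≡ a ⊕H e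

  record System (H : Set) : Set c where
    field
      M  : ℕ
      J  : Fin M → ℕ
      E′ : Fin M → H → Bool
      h  : (i : Fin M) → Fin (J i) → Carrier
      E  : (i : Fin M) → Fin (J i) → H → Bool

  -- α satisfies the system: for all i and x ∈ G, the sets
  -- α(x + h_{i,j}) + E_{i,j} (j ≤ J_i) are pairwise disjoint with union E′_i
  Satisfies : {H : Set} (_⊕H_ : H → H → H) → System H → (Carrier → H) → Set c
  Satisfies {H} _⊕H_ S α =
    ∀ (i : Fin M) (x : Carrier) →
      (∀ (j j′ : Fin (J i)) → j ≢ j′ → ∀ (y : H) →
         ¬ ((y ∈ α (x ∙ h i j) +S E i j) × (y ∈ α (x ∙ h i j′) +S E i j′)))
      × (∀ (y : H) →
           (E′ i y ≡ true → Σ (Fin (J i)) λ j → y ∈ α (x ∙ h i j) +S E i j)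
         × ((Σ (Fin (J i)) λ j → y ∈ α (x ∙ h i j) +S E i j) → E′ i y ≡ true))
    where
      open System S
      _∈_+S_ : H → H → (H → Bool) → Set
      y ∈ a +S F = InTranslate _⊕H_ y a F

  Expressible : ∀ {p} (H : Set) (_⊕H_ : H → H → H) → (Fun H → Set p) → Set (c ⊔ ℓ ⊔ p)
  Expressible H _⊕H_ P =
    Σ (System H) λ S → ∀ (α : Fun H) →
      (P α → Satisfies _⊕H_ S (proj₁ α)) × (Satisfies _⊕H_ S (proj₁ α) → P α)

  -- the property c₁α₁(x) + … + c_Uα_U(x) = 0 for all x ∈ G, of the tuple
  -- (α_u)_u, identified with α : G → (Z/LZ)^U
  LinZero : (L : ℕ) .{{_ : NonZero L}} (U : ℕ) → Vec (Fin L) U → Fun (Vec (Fin L) U) → Set c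
  LinZero L U cs α = ∀ (x : Carrier) → linForm L cs (proj₁ α x) ≡ 0L L

-- The kernel K of y ↦ c₁y₁ + … + c_U y_U is a subgroup of (Z/LZ)^U, and a translate a + K of a
-- subgroup equals K exactly when a ∈ K. So a single equation, with shift 0 and E = E′ = K, saying
-- α(x) + K = K for all x, expresses the property.
module Submission where

open import Defs
open import Level using (Level)
open import Algebra.Bundles using (AbelianGroup)
open AbelianGroup using (Carrier)
open import Data.Nat using (ℕ; NonZero)
open import Data.Fin using (Fin)
open import Data.Vec using (Vec)

open import Data.Nat using (_+_; _*_; _∸_; _%_; >-nonZero⁻¹)
open import Data.Nat.Properties using (+-comm; +-assoc; +-commutativeSemigroup; +-identityʳ; *-zeroʳ; *-distribˡ-+; <⇒≤; m+[n∸m]≡n)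
open import Data.Nat.DivMod
open import Algebra.Properties.CommutativeSemigroup +-commutativeSemigroup using (interchange)
open import Data.Fin using (toℕ) renaming (zero to fzero)
open import Data.Fin.Properties using (toℕ-fromℕ<; toℕ-injective; toℕ<n; _≟_)
open import Data.Vec using ([]; _∷_; replicate; zipWith)
open import Data.Bool using (Bool; true)
open import Data.Product using (Σ; _×_; _,_; proj₁; proj₂)
open import Function using (_∘_)
open import Function.Bundles using (_⇔_; mk⇔; Equivalence)
open import Relation.Nullary using (Dec; yes; does)
open import Relation.Nullary.Decidable using (dec-true)
open import Relation.Binary.PropositionalEquality
open ≡-Reasoning

does-true⇒ : ∀ {p} {P : Set p} (p? : Dec P) → does p? ≡ true → P
does-true⇒ (yes p) _ = p

module _ (L : ℕ) .{{_ : NonZero L}} where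

  %-absorbˡ-+ : ∀ m n → (m % L + n) % L ≡ (m + n) % L
  %-absorbˡ-+ m n = begin
    (m % L + n) % L             ≡⟨ %-distribˡ-+ (m % L) n L ⟩
    (m % L % L + n % L) % L     ≡⟨ cong (λ t → (t + n % L) % L) (m%n%n≡m%n m L) ⟩
    (m % L + n % L) % L         ≡⟨ %-distribˡ-+ m n L ⟨
    (m + n) % L                 ∎

  %-absorbʳ-+ : ∀ m n → (m + n % L) % L ≡ (m + n) % L
  %-absorbʳ-+ m n = begin
    (m + n % L) % L  ≡⟨ cong (_% L) (+-comm m (n % L)) ⟩
    (n % L + m) % L  ≡⟨ %-absorbˡ-+ n m ⟩
    (n + m) % L      ≡⟨ cong (_% L) (+-comm n m) ⟩
    (m + n) % L      ∎

  %-absorbʳ-* : ∀ m n → (m * (n % L)) % L ≡ (m * n) % L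
  %-absorbʳ-* m n = begin
    (m * (n % L)) % L            ≡⟨ %-distribˡ-* m (n % L) L ⟩
    (m % L * (n % L % L)) % L    ≡⟨ cong (λ t → (m % L * t) % L) (m%n%n≡m%n n L) ⟩
    (m % L * (n % L)) % L        ≡⟨ %-distribˡ-* m n L ⟨
    (m * n) % L                  ∎

  toℕ-mod : ∀ m → toℕ (m mod L) ≡ m % L
  toℕ-mod m = toℕ-fromℕ< _

  toℕ-0L : toℕ (0L L) ≡ 0
  toℕ-0L = trans (toℕ-mod 0) (m<n⇒m%n≡m (>-nonZero⁻¹ L))

  toℕ%L : (a : Fin L) → toℕ a % L ≡ toℕ a
  toℕ%L a = m<n⇒m%n≡m (toℕ<n a)

  +L-identityˡ : (a : Fin L) → _+L_ L (0L L) a ≡ a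
  +L-identityˡ a = toℕ-injective (begin
    toℕ (_+L_ L (0L L) a)       ≡⟨ toℕ-mod _ ⟩
    (toℕ (0L L) + toℕ a) % L    ≡⟨ cong (λ t → (t + toℕ a) % L) toℕ-0L ⟩
    toℕ a % L                   ≡⟨ toℕ%L a ⟩
    toℕ a                       ∎)

  +L-identityʳ : (a : Fin L) → _+L_ L a (0L L) ≡ a
  +L-identityʳ a = toℕ-injective (begin
    toℕ (_+L_ L a (0L L))       ≡⟨ toℕ-mod _ ⟩
    (toℕ a + toℕ (0L L)) % L    ≡⟨ cong (λ t → (toℕ a + t) % L) toℕ-0L ⟩
    (toℕ a + 0) % L             ≡⟨ cong (_% L) (+-identityʳ (toℕ a)) ⟩
    toℕ a % L                   ≡⟨ toℕ%L a ⟩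
    toℕ a                       ∎)

  _-L_ : Fin L → Fin L → Fin L
  b -L a = (toℕ b + (L ∸ toℕ a)) mod L

  +L-[-L] : (a b : Fin L) → _+L_ L a (b -L a) ≡ b
  +L-[-L] a b = toℕ-injective (begin
    toℕ (_+L_ L a (b -L a))                     ≡⟨ toℕ-mod _ ⟩
    (toℕ a + toℕ (b -L a)) % L                  ≡⟨ cong (λ t → (toℕ a + t) % L) (toℕ-mod _) ⟩
    (toℕ a + (toℕ b + (L ∸ toℕ a)) % L) % L     ≡⟨ %-absorbʳ-+ (toℕ a) _ ⟩
    (toℕ a + (toℕ b + (L ∸ toℕ a))) % L         ≡⟨ cong (_% L) a+[b+[L∸a]]≡b+L ⟩
    (toℕ b + L) % L                             ≡⟨ [m+n]%n≡m%n (toℕ b) L ⟩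
    toℕ b % L                                   ≡⟨ toℕ%L b ⟩
    toℕ b                                       ∎)
    where
    a+[b+[L∸a]]≡b+L : toℕ a + (toℕ b + (L ∸ toℕ a)) ≡ toℕ b + L
    a+[b+[L∸a]]≡b+L = begin
      toℕ a + (toℕ b + (L ∸ toℕ a))   ≡⟨ cong (toℕ a +_) (+-comm (toℕ b) _) ⟩
      toℕ a + ((L ∸ toℕ a) + toℕ b)   ≡⟨ +-assoc (toℕ a) _ _ ⟨
      (toℕ a + (L ∸ toℕ a)) + toℕ b   ≡⟨ cong (_+ toℕ b) (m+[n∸m]≡n (<⇒≤ (toℕ<n a))) ⟩
      L + toℕ b                       ≡⟨ +-comm L (toℕ b) ⟩
      toℕ b + L                       ∎

  0V : ∀ U → Vec (Fin L) U
  0V U = replicate U (0L L)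

  ⊕-identityʳ : ∀ {U} (a : Vec (Fin L) U) → _⊕_ L a (0V U) ≡ a
  ⊕-identityʳ []       = refl
  ⊕-identityʳ (a ∷ as) = cong₂ _∷_ (+L-identityʳ a) (⊕-identityʳ as)

  _⊖_ : ∀ {U} → Vec (Fin L) U → Vec (Fin L) U → Vec (Fin L) U
  _⊖_ = zipWith _-L_

  ⊕-[⊖] : ∀ {U} (a b : Vec (Fin L) U) → _⊕_ L a (b ⊖ a) ≡ b
  ⊕-[⊖] []       []       = refl
  ⊕-[⊖] (a ∷ as) (b ∷ bs) = cong₂ _∷_ (+L-[-L] a b) (⊕-[⊖] as bs)

  dot : ∀ {U} → Vec (Fin L) U → Vec (Fin L) U → ℕ
  dot []       []       = 0
  dot (c ∷ cs) (y ∷ ys) = toℕ c * toℕ y + dot cs ys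

  toℕ-linForm : ∀ {U} (cs ys : Vec (Fin L) U) → toℕ (linForm L cs ys) ≡ dot cs ys % L
  toℕ-linForm []       []       = toℕ-mod 0
  toℕ-linForm (c ∷ cs) (y ∷ ys) = begin
    toℕ (_+L_ L (_*L_ L c y) (linForm L cs ys))             ≡⟨ toℕ-mod _ ⟩
    (toℕ (_*L_ L c y) + toℕ (linForm L cs ys)) % L          ≡⟨ cong₂ (λ p q → (p + q) % L) (toℕ-mod _) (toℕ-linForm cs ys) ⟩
    ((toℕ c * toℕ y) % L + dot cs ys % L) % L               ≡⟨ %-distribˡ-+ (toℕ c * toℕ y) (dot cs ys) L ⟨
    (toℕ c * toℕ y + dot cs ys) % L                         ∎

  dot-⊕ : ∀ {U} (cs a b : Vec (Fin L) U) → dot cs (_⊕_ L a b) % L ≡ (dot cs a + dot cs b) % L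
  dot-⊕ []       []       []       = refl
  dot-⊕ (c ∷ cs) (a ∷ as) (b ∷ bs) = begin
    (c′ * toℕ (_+L_ L a b) + dot cs (_⊕_ L as bs)) % L             ≡⟨ %-absorbˡ-+ _ _ ⟨
    ((c′ * toℕ (_+L_ L a b)) % L + dot cs (_⊕_ L as bs)) % L       ≡⟨ cong (λ t → ((c′ * t) % L + dot cs (_⊕_ L as bs)) % L) (toℕ-mod _) ⟩
    ((c′ * ((a′ + b′) % L)) % L + dot cs (_⊕_ L as bs)) % L        ≡⟨ cong (λ t → (t + dot cs (_⊕_ L as bs)) % L) (%-absorbʳ-* c′ _) ⟩
    ((c′ * (a′ + b′)) % L + dot cs (_⊕_ L as bs)) % L              ≡⟨ %-absorbˡ-+ _ _ ⟩
    (c′ * (a′ + b′) + dot cs (_⊕_ L as bs)) % L                    ≡⟨ %-absorbʳ-+ _ _ ⟨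
    (c′ * (a′ + b′) + dot cs (_⊕_ L as bs) % L) % L                ≡⟨ cong (λ t → (c′ * (a′ + b′) + t) % L) (dot-⊕ cs as bs) ⟩
    (c′ * (a′ + b′) + (dot cs as + dot cs bs) % L) % L             ≡⟨ %-absorbʳ-+ _ _ ⟩
    (c′ * (a′ + b′) + (dot cs as + dot cs bs)) % L                 ≡⟨ cong (λ t → (t + (dot cs as + dot cs bs)) % L) (*-distribˡ-+ c′ a′ b′) ⟩
    ((c′ * a′ + c′ * b′) + (dot cs as + dot cs bs)) % L            ≡⟨ cong (_% L) (interchange (c′ * a′) _ _ _) ⟩
    ((c′ * a′ + dot cs as) + (c′ * b′ + dot cs bs)) % L            ∎
    where
    a′ = toℕ a
    b′ = toℕ b
    c′ = toℕ c

  linForm-⊕ : ∀ {U} (cs a b : Vec (Fin L) U) →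
              linForm L cs (_⊕_ L a b) ≡ _+L_ L (linForm L cs a) (linForm L cs b)
  linForm-⊕ cs a b = toℕ-injective (begin
    toℕ (linForm L cs (_⊕_ L a b))                      ≡⟨ toℕ-linForm cs _ ⟩
    dot cs (_⊕_ L a b) % L                              ≡⟨ dot-⊕ cs a b ⟩
    (dot cs a + dot cs b) % L                           ≡⟨ %-distribˡ-+ (dot cs a) (dot cs b) L ⟩
    (dot cs a % L + dot cs b % L) % L                   ≡⟨ cong₂ (λ p q → (p + q) % L) (toℕ-linForm cs a) (toℕ-linForm cs b) ⟨
    (toℕ (linForm L cs a) + toℕ (linForm L cs b)) % L   ≡⟨ toℕ-mod _ ⟨
    toℕ (_+L_ L (linForm L cs a) (linForm L cs b))      ∎)

  dot-0V : ∀ {U} (cs : Vec (Fin L) U) → dot cs (0V U) ≡ 0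
  dot-0V []       = refl
  dot-0V (c ∷ cs) = begin
    toℕ c * toℕ (0L L) + dot cs (0V _)   ≡⟨ cong₂ (λ p q → toℕ c * p + q) toℕ-0L (dot-0V cs) ⟩
    toℕ c * 0 + 0                        ≡⟨ +-identityʳ _ ⟩
    toℕ c * 0                            ≡⟨ *-zeroʳ (toℕ c) ⟩
    0                                    ∎

  linForm-0V : ∀ {U} (cs : Vec (Fin L) U) → linForm L cs (0V U) ≡ 0L L
  linForm-0V cs = toℕ-injective (begin
    toℕ (linForm L cs (0V _))   ≡⟨ toℕ-linForm cs _ ⟩
    dot cs (0V _) % L           ≡⟨ cong (_% L) (dot-0V cs) ⟩
    0 % L                       ≡⟨ toℕ-mod 0 ⟨
    toℕ (0L L)                  ∎)

module _ {H : Set} (_⊕H_ : H → H → H) where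

  Stabilises : H → (H → Bool) → Set
  Stabilises a K = ∀ y → (K y ≡ true → Σ H λ e → K e ≡ true × y ≡ a ⊕H e)
                       × ((Σ H λ e → K e ≡ true × y ≡ a ⊕H e) → K y ≡ true)

  module _ {c ℓ} (G : AbelianGroup c ℓ) where
    open AbelianGroup G using (ε; _∙_)

    translateSystem : (H → Bool) → System G H
    translateSystem K = record { M = 1 ; J = λ _ → 1 ; E′ = λ _ → K ; h = λ _ _ → ε ; E = λ _ _ → K }

    satisfies-translateSystem⇔ : (K : H → Bool) (α : Carrier G → H) →
      Satisfies G _⊕H_ (translateSystem K) α ⇔ (∀ x → Stabilises (α (x ∙ ε)) K)
    satisfies-translateSystem⇔ K α = mk⇔ to from
      where
      to : Satisfies G _⊕H_ (translateSystem K) α → ∀ x → Stabilises (α (x ∙ ε)) K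
      to sat x y with proj₂ (sat fzero x) y
      ... | covered , inside = proj₂ ∘ covered , λ e∈ → inside (fzero , e∈)

      from : (∀ x → Stabilises (α (x ∙ ε)) K) → Satisfies G _⊕H_ (translateSystem K) α
      from stab fzero x = (λ { fzero fzero j≢j′ _ _ → j≢j′ refl })
                        , λ y → (λ Ky → fzero , proj₁ (stab x y) Ky)
                              , λ { (fzero , e∈) → proj₂ (stab x y) e∈ }

module _ (L : ℕ) .{{_ : NonZero L}} {U : ℕ} (cs : Vec (Fin L) U) where

  ker : Vec (Fin L) U → Bool
  ker v = does (linForm L cs v ≟ 0L L)

  stabilises-ker⇔ : (a : Vec (Fin L) U) → Stabilises (_⊕_ L) a ker ⇔ linForm L cs a ≡ 0L L
  stabilises-ker⇔ a = mk⇔ to from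
    where
    to : Stabilises (_⊕_ L) a ker → linForm L cs a ≡ 0L L
    to stab = does-true⇒ (_ ≟ _) (proj₂ (stab a) (0V L U , dec-true (_ ≟ _) (linForm-0V L cs) , sym (⊕-identityʳ L a)))

    from : linForm L cs a ≡ 0L L → Stabilises (_⊕_ L) a ker
    from a∈ker y = (λ y∈ker → _⊖_ L y a , dec-true (_ ≟ _) (difference-in-ker (does-true⇒ (_ ≟ _) y∈ker)) , sym (⊕-[⊖] L a y))
                 , λ { (e , e∈ker , refl) → dec-true (_ ≟ _) (sum-in-ker (does-true⇒ (_ ≟ _) e∈ker)) }
      where
      sum-in-ker : ∀ {e} → linForm L cs e ≡ 0L L → linForm L cs (_⊕_ L a e) ≡ 0L L
      sum-in-ker {e} e∈ker = begin
        linForm L cs (_⊕_ L a e)                      ≡⟨ linForm-⊕ L cs a e ⟩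
        _+L_ L (linForm L cs a) (linForm L cs e)      ≡⟨ cong₂ (_+L_ L) a∈ker e∈ker ⟩
        _+L_ L (0L L) (0L L)                          ≡⟨ +L-identityˡ L (0L L) ⟩
        0L L                                          ∎

      difference-in-ker : linForm L cs y ≡ 0L L → linForm L cs (_⊖_ L y a) ≡ 0L L
      difference-in-ker y∈ker = begin
        linForm L cs (_⊖_ L y a)                            ≡⟨ +L-identityˡ L _ ⟨
        _+L_ L (0L L) (linForm L cs (_⊖_ L y a))            ≡⟨ cong (λ t → _+L_ L t (linForm L cs (_⊖_ L y a))) a∈ker ⟨
        _+L_ L (linForm L cs a) (linForm L cs (_⊖_ L y a))  ≡⟨ linForm-⊕ L cs a _ ⟨
        linForm L cs (_⊕_ L a (_⊖_ L y a))                  ≡⟨ cong (linForm L cs) (⊕-[⊖] L a y) ⟩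
        linForm L cs y                                      ≡⟨ y∈ker ⟩
        0L L                                                ∎

lemma6p9 : ∀ {c ℓ} (G : AbelianGroup c ℓ) → IsFinitelyGenerated G →
    (L : ℕ) .{{_ : NonZero L}} (U : ℕ) (cs : Vec (Fin L) U) →
    Expressible G (Vec (Fin L) U) (_⊕_ L) (LinZero G L U cs)
lemma6p9 G _ L U cs = translateSystem (_⊕_ L) G (ker L cs) , λ (f , f-cong) → linZero⇒sat f , sat⇒linZero f f-cong
  where
  open AbelianGroup G using (_≈_; ε; _∙_; identityʳ)
  open Equivalence

  linZero⇒sat : (f : Carrier G → Vec (Fin L) U) → (∀ x → linForm L cs (f x) ≡ 0L L) →
                Satisfies G (_⊕_ L) (translateSystem (_⊕_ L) G (ker L cs)) f
  linZero⇒sat f f∈ker = from (satisfies-translateSystem⇔ (_⊕_ L) G (ker L cs) f)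
                          (λ x → from (stabilises-ker⇔ L cs _) (f∈ker (x ∙ ε)))

  sat⇒linZero : (f : Carrier G → Vec (Fin L) U) → (∀ {x y} → x ≈ y → f x ≡ f y) →
                Satisfies G (_⊕_ L) (translateSystem (_⊕_ L) G (ker L cs)) f → ∀ x → linForm L cs (f x) ≡ 0L L
  sat⇒linZero f f-cong sat x = begin
    linForm L cs (f x)         ≡⟨ cong (linForm L cs) (f-cong (identityʳ x)) ⟨
    linForm L cs (f (x ∙ ε))   ≡⟨ to (stabilises-ker⇔ L cs _) (to (satisfies-translateSystem⇔ (_⊕_ L) G (ker L cs) f) sat x) ⟩
    0L L                       ∎
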